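{- For every nonempty word $\mathbf{w}$ over $S_{\mathbb{N}}$, in $(\mathcal{H},*)$ one has $$\sum_{(\alpha_1,\alpha_2)=\mathbf{w}}(-1)^{l(\alpha_1)}f(\alpha_1)*\alpha_2=0,$$ where the sum is over all ways of writing $\mathbf{w}$ as a concatenation $\alpha_1\alpha_2$ of two (possibly empty) words, and $f$ is defined by $f(1)=1$ and, for a nonempty word $\gamma$, $f(\gamma)=\sum\mathrm{Rev}(|\beta_1|,\dots,|\beta_k|)$, the sum over all decompositions $\gamma=\beta_1\beta_2\cdots\beta_k$ ($k\ge1$) of $\gamma$ as a concatenation of nonempty words.
   Context: Let $s_1,s_2,\dots$ be formal symbols and $S_{\mathbb{N}}$ the commutative semigroup of formal sums $\sum_i a_is_i$ ($a_i\in\mathbb{N}_0$, finitely many nonzero, not all zero). Words are finite sequences of elements of $S_{\mathbb{N}}$, including the empty word $1$; $\mathcal{H}$ is the $\mathbb{Q}$-vector space with basis the words. For $x=\sum c_\alpha\alpha$ and $u\in S_{\mathbb{N}}$, $(\{x\},u):=\sum c_\alpha(\alpha,u)$. The harmonic product $*$ is the $\mathbb{Q}$-bilinear map with $\mathbf{w}*1=1*\mathbf{w}=\mathbf{w}$ and $(\mathbf{w}_1,u_1)*(\mathbf{w}_2,u_2)=(\{\mathbf{w}_1*(\mathbf{w}_2,u_2)\},u_1)+(\{(\mathbf{w}_1,u_1)*\mathbf{w}_2\},u_2)+(\{\mathbf{w}_1*\mathbf{w}_2\},u_1+u_2)$. For a word $(u_1,\dots,u_k)$: $l(u_1,\dots,u_k)=k$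 ($l(1)=0$), $|(u_1,\dots,u_k)|=u_1+\cdots+u_k\in S_{\mathbb{N}}$, and $\mathrm{Rev}(u_1,\dots,u_k)=(u_k,\dots,u_1)$. -}

module Defs where

open import Data.Nat as ℕ using (ℕ; zero; suc)
open import Data.List using (List; []; _∷_; [_]; map; _++_; concatMap; reverse; length)
open import Data.List.NonEmpty as L⁺ using (List⁺; _∷_; _∷⁺_; toList; foldr₁)
import Data.List.Properties as LP
open import Data.Product using (_×_; _,_; map₁)
open import Data.Rational using (ℚ; 0ℚ; 1ℚ; -_; _*_; _+_)
open import Data.Bool using (if_then_else_)
open import Relation.Nullary using (yes; no; does)
open import Relation.Binary.PropositionalEquality using (_≡_; refl; cong₂)
open import Relation.Binary.Definitions using (DecidableEquality)

-- The semigroup S_ℕ of nonzero formal sums  Σ aᵢ sᵢ  (aᵢ ∈ ℕ₀, finitely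
-- many nonzero, not all zero).  Canonical representation (no proofs, so
-- propositional equality is equality of formal sums):
--   mk xs k  represents the coefficient sequence  xs ++ [ suc k ] ,
-- i.e. a₁ s₁ + … + a_m s_m + (k+1) s_{m+1} with xs = a₁ … a_m.
-- (Every nonzero formal sum has a unique last nonzero coefficient.)

record SN : Set where
  constructor mk
  field
    init : List ℕ
    last : ℕ

-- the generator s_{i+1}  (s₁ = s 0)
s : ℕ → SN
s i = mk (rep i) 0
  where
  rep : ℕ → List ℕ
  rep zero = []
  rep (suc n) = 0 ∷ rep n

private
  consS : ℕ → SN → SN
  consS c (mk zs k) = mk (c ∷ zs) k

infixl 6 _⊕_
_⊕_ : SN → SN → SN
mk [] a ⊕ mk [] b = mk [] (suc (a ℕ.+ b))
mk [] a ⊕ mk (y ∷ ys) b = mk (suc a ℕ.+ y ∷ ys) b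
mk (x ∷ xs) a ⊕ mk [] b = mk (x ℕ.+ suc b ∷ xs) a
mk (x ∷ xs) a ⊕ mk (y ∷ ys) b = consS (x ℕ.+ y) (mk xs a ⊕ mk ys b)

_≟S_ : DecidableEquality SN
mk xs a ≟S mk ys b with LP.≡-dec ℕ._≟_ xs ys | a ℕ.≟ b
... | yes refl | yes refl = yes refl
... | no ne | _ = no λ { refl → ne refl }
... | yes _ | no ne = no λ { refl → ne refl }

Word : Set
Word = List SN

_≟W_ : DecidableEquality Word
_≟W_ = LP.≡-dec _≟S_

-- 𝓗 : the ℚ-vector space with basis the words.  An element is a finite
-- formal linear combination, represented by a list of (coefficient, word)
-- pairs; two representations denote the same vector iff every word has the
-- same total coefficient (`coeff`).

H : Set
H = List (ℚ × Word)

coeff : H → Word → ℚ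
coeff [] u = 0ℚ
coeff ((c , v) ∷ x) u = if does (v ≟W u) then c + coeff x u else coeff x u

IsZero : H → Set
IsZero x = ∀ u → coeff x u ≡ 0ℚ

word : Word → H
word w = [ (1ℚ , w) ]

scale : ℚ → H → H
scale c = map (λ { (d , v) → (c * d , v) })

-- The recursion in the paper peels off the LAST letter;
-- `starRev` works on reversed words (head = last letter) and returns the
-- list of (reversed) words occurring, each with coefficient 1:
--  (w₁,u₁)*(w₂,u₂) = (w₁*(w₂,u₂), u₁) + ((w₁,u₁)*w₂, u₂) + (w₁*w₂, u₁+u₂).

starRev : Word → Word → List Word
starRev [] b = [ b ]
starRev (u₁ ∷ w₁) [] = [ u₁ ∷ w₁ ]
starRev (u₁ ∷ w₁) (u₂ ∷ w₂) =
  map (u₁ ∷_) (starRev w₁ (u₂ ∷ w₂)) ++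
  map (u₂ ∷_) (starRev (u₁ ∷ w₁) w₂) ++
  map ((u₁ ⊕ u₂) ∷_) (starRev w₁ w₂)

starW : Word → Word → H
starW a b = map (λ v → (1ℚ , reverse v)) (starRev (reverse a) (reverse b))

infixl 7 _⋆_
_⋆_ : H → H → H
x ⋆ y = concatMap (λ { (c , v) → concatMap (λ { (d , w) → scale (c * d) (starW v w) }) y }) x

l : Word → ℕ
l = length

∣_∣ : List⁺ SN → SN
∣_∣ = foldr₁ _⊕_

Rev : Word → Word
Rev = reverse

decomps : SN → List SN → List (List⁺ (List⁺ SN))
decomps x [] = [ (x ∷ []) ∷ [] ]
decomps x (y ∷ ys) =
  map ((x ∷ []) ∷⁺_) (decomps y ys) ++
  map (λ { (b ∷ bs) → (x ∷⁺ b) ∷ bs }) (decomps y ys)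

f : Word → H
f [] = word []
f (x ∷ xs) = map (λ bs → (1ℚ , Rev (map ∣_∣ (toList bs)))) (decomps x xs)

splits : Word → List (Word × Word)
splits [] = [ ([] , []) ]
splits (x ∷ xs) = ([] , x ∷ xs) ∷ map (map₁ (x ∷_)) (splits xs)

sign : ℕ → ℚ
sign zero = 1ℚ
sign (suc n) = - sign n

lhs : Word → H
lhs w = concatMap (λ { (α₁ , α₂) → scale (sign (l α₁)) (f α₁ ⋆ word α₂) }) (splits w)

-- Write N(w) for the left-hand side and z·a for z with the letter a appended
-- to each word; we show N(w) = 0 by induction on the length of
-- w = x v y.  Expanding the products along the last letter y splits N(w) into
-- N(x v)·y, the term (-1)^{l(w)} f(w), and a remainder.  Expanding f along its
-- first block and exchanging the two splittings, the remainder regroups into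
-- N(r) and into N(r y) without its last term, over the suffixes r of v.  By
-- induction these are 0 and (-1)^{l(r)} f(r y), and the remainder becomes
-- (-1)^{l(x v)} Σ f(q)·|x p| over the splittings p q of v y, which is
-- (-1)^{l(x v)} f(w) and cancels against (-1)^{l(w)} f(w).
module Submission where

open import Defs
open import Data.List using ([])
open import Relation.Binary.PropositionalEquality using (_≢_)

open import Algebra.Bundles using (CommutativeMonoid)
open import Data.Bool using (true; false)
open import Data.Empty using (⊥-elim)
open import Data.List as List using (List; _∷_; [_]; _++_; _∷ʳ_; map; concatMap; reverse; length; initLast; _∷ʳ′_)
import Data.List.Properties as List
open import Data.List.NonEmpty as List⁺ using (List⁺; _∷_; _∷⁺_; toList)
open import Data.Nat as ℕ using (ℕ; zero; suc; s≤s)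
import Data.Nat.Properties as ℕ
open import Data.Nat.Induction using (<-wellFounded)
open import Data.Product using (_×_; _,_; proj₁; proj₂; map₂; uncurry)
open import Data.Rational using (ℚ; 0ℚ; 1ℚ; -_; _+_; _*_)
import Data.Rational.Properties as ℚ
open import Function using (_∘_)
open import Induction.WellFounded using (module All)
import Relation.Binary.Construct.On as On
open import Relation.Binary.Bundles using (Setoid)
open import Relation.Binary.PropositionalEquality
  using (_≡_; refl; sym; trans; cong; cong₂; module ≡-Reasoning)
open import Relation.Nullary using (does)
import Relation.Binary.Reasoning.Setoid

-- Equality in 𝓗

infix 4 _≈_

-- The identities of the ℚ-vector space with basis Word, closed under the list
-- operations; by ≈⇒coeff≡ they only identify vectors with equal coefficients.
data _≈_ : H → H → Set where
  ≈-refl  : ∀ {x} → x ≈ x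
  ≈-sym   : ∀ {x y} → x ≈ y → y ≈ x
  ≈-trans : ∀ {x y z} → x ≈ y → y ≈ z → x ≈ z
  ++-cong : ∀ {x x′ y y′} → x ≈ x′ → y ≈ y′ → x ++ y ≈ x′ ++ y′
  ++-comm : ∀ x y → x ++ y ≈ y ++ x
  merge   : ∀ c d w → (c , w) ∷ (d , w) ∷ [] ≈ (c + d , w) ∷ []
  drop-0  : ∀ w → (0ℚ , w) ∷ [] ≈ []

≡⇒≈ : ∀ {x y} → x ≡ y → x ≈ y
≡⇒≈ refl = ≈-refl

coeff-++ : ∀ x y u → coeff (x ++ y) u ≡ coeff x u + coeff y u
coeff-++ [] y u = sym (ℚ.+-identityˡ _)
coeff-++ ((c , v) ∷ x) y u with does (v ≟W u)
... | true  = trans (cong (c +_) (coeff-++ x y u)) (sym (ℚ.+-assoc c _ _))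
... | false = coeff-++ x y u

≈⇒coeff≡ : ∀ {x y} → x ≈ y → ∀ u → coeff x u ≡ coeff y u
≈⇒coeff≡ ≈-refl u = refl
≈⇒coeff≡ (≈-sym p) u = sym (≈⇒coeff≡ p u)
≈⇒coeff≡ (≈-trans p q) u = trans (≈⇒coeff≡ p u) (≈⇒coeff≡ q u)
≈⇒coeff≡ (++-cong {x} {x′} {y} {y′} p q) u = begin
  coeff (x ++ y) u         ≡⟨ coeff-++ x y u ⟩
  coeff x u + coeff y u    ≡⟨ cong₂ _+_ (≈⇒coeff≡ p u) (≈⇒coeff≡ q u) ⟩
  coeff x′ u + coeff y′ u  ≡⟨ coeff-++ x′ y′ u ⟨
  coeff (x′ ++ y′) u       ∎
  where open ≡-Reasoning
≈⇒coeff≡ (++-comm x y) u = begin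
  coeff (x ++ y) u       ≡⟨ coeff-++ x y u ⟩
  coeff x u + coeff y u  ≡⟨ ℚ.+-comm (coeff x u) (coeff y u) ⟩
  coeff y u + coeff x u  ≡⟨ coeff-++ y x u ⟨
  coeff (y ++ x) u       ∎
  where open ≡-Reasoning
≈⇒coeff≡ (merge c d w) u with does (w ≟W u)
... | true  = sym (ℚ.+-assoc c d 0ℚ)
... | false = refl
≈⇒coeff≡ (drop-0 w) u with does (w ≟W u)
... | true  = refl
... | false = refl

≈-setoid : Setoid _ _
≈-setoid = record
  { Carrier       = H
  ; _≈_           = _≈_
  ; isEquivalence = record { refl = ≈-refl ; sym = ≈-sym ; trans = ≈-trans }
  }

module ≈-Reasoning = Relation.Binary.Reasoning.Setoid ≈-setoid

++-commutativeMonoid : CommutativeMonoid _ _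
++-commutativeMonoid = record
  { Carrier             = H
  ; _≈_                 = _≈_
  ; _∙_                 = _++_
  ; ε                   = []
  ; isCommutativeMonoid = record
    { isMonoid = record
      { isSemigroup = record
        { isMagma = record
          { isEquivalence = Setoid.isEquivalence ≈-setoid
          ; ∙-cong        = ++-cong
          }
        ; assoc = λ x y z → ≡⇒≈ (List.++-assoc x y z)
        }
      ; identity = (λ _ → ≈-refl) , (λ x → ≡⇒≈ (List.++-identityʳ x))
      }
    ; comm = ++-comm
    }
  }

open import Algebra.Properties.CommutativeSemigroup
  (CommutativeMonoid.commutativeSemigroup ++-commutativeMonoid)
  using (interchange; x∙yz≈y∙xz)

scale-++ : ∀ c x y → scale c (x ++ y) ≡ scale c x ++ scale c y
scale-++ c = List.map-++ _

scale-scale : ∀ c d x → scale c (scale d x) ≡ scale (c * d) x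
scale-scale c d [] = refl
scale-scale c d ((e , w) ∷ x) =
  cong₂ _∷_ (cong (_, w) (sym (ℚ.*-assoc c d e))) (scale-scale c d x)

scale-1 : ∀ x → scale 1ℚ x ≡ x
scale-1 [] = refl
scale-1 ((e , w) ∷ x) = cong₂ _∷_ (cong (_, w) (ℚ.*-identityˡ e)) (scale-1 x)

scale-+ : ∀ c d x → scale c x ++ scale d x ≈ scale (c + d) x
scale-+ c d [] = ≈-refl
scale-+ c d ((e , w) ∷ x) = begin
  ((c * e , w) ∷ scale c x) ++ ((d * e , w) ∷ scale d x)
    ≈⟨ ++-cong {[ (c * e , w) ]} ≈-refl (x∙yz≈y∙xz (scale c x) [ (d * e , w) ] (scale d x)) ⟩
  (c * e , w) ∷ (d * e , w) ∷ (scale c x ++ scale d x)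
    ≈⟨ ++-cong (merge (c * e) (d * e) w) (scale-+ c d x) ⟩
  (c * e + d * e , w) ∷ scale (c + d) x
    ≡⟨ cong (λ q → (q , w) ∷ scale (c + d) x) (sym (ℚ.*-distribʳ-+ e c d)) ⟩
  scale (c + d) ((e , w) ∷ x) ∎
  where open ≈-Reasoning

scale-0 : ∀ x → scale 0ℚ x ≈ []
scale-0 [] = ≈-refl
scale-0 ((e , w) ∷ x) =
  ++-cong (≈-trans (≡⇒≈ (cong (λ q → [ (q , w) ]) (ℚ.*-zeroˡ e))) (drop-0 w)) (scale-0 x)

scale-cancel : ∀ c x → scale c x ++ scale (- c) x ≈ []
scale-cancel c x = begin
  scale c x ++ scale (- c) x  ≈⟨ scale-+ c (- c) x ⟩
  scale (c + - c) x           ≡⟨ cong (λ q → scale q x) (ℚ.+-inverseʳ c) ⟩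
  scale 0ℚ x                  ≈⟨ scale-0 x ⟩
  []                          ∎
  where open ≈-Reasoning

scale-cong : ∀ c {x y} → x ≈ y → scale c x ≈ scale c y
scale-cong c ≈-refl = ≈-refl
scale-cong c (≈-sym p) = ≈-sym (scale-cong c p)
scale-cong c (≈-trans p q) = ≈-trans (scale-cong c p) (scale-cong c q)
scale-cong c (++-cong {x} {x′} {y} {y′} p q) =
  ≈-trans (≡⇒≈ (scale-++ c x y))
    (≈-trans (++-cong (scale-cong c p) (scale-cong c q)) (≡⇒≈ (sym (scale-++ c x′ y′))))
scale-cong c (++-comm x y) =
  ≈-trans (≡⇒≈ (scale-++ c x y))
    (≈-trans (++-comm (scale c x) (scale c y)) (≡⇒≈ (sym (scale-++ c y x))))
scale-cong c (merge a b w) =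
  ≈-trans (merge _ _ w) (≡⇒≈ (cong (λ q → [ (q , w) ]) (sym (ℚ.*-distribˡ-+ c a b))))
scale-cong c (drop-0 w) = ≈-trans (≡⇒≈ (cong (λ q → [ (q , w) ]) (ℚ.*-zeroʳ c))) (drop-0 w)

++≈[]⇒≈-neg : ∀ {x y} → x ++ y ≈ [] → x ≈ scale (- 1ℚ) y
++≈[]⇒≈-neg {x} {y} x+y≈0 = begin
  x                               ≈⟨ ≡⇒≈ (List.++-identityʳ x) ⟨
  x ++ []                         ≈⟨ ++-cong {x} ≈-refl (scale-cancel 1ℚ y) ⟨
  x ++ (scale 1ℚ y ++ scale (- 1ℚ) y)
                                  ≡⟨ cong (λ z → x ++ (z ++ scale (- 1ℚ) y)) (scale-1 y) ⟩
  x ++ (y ++ scale (- 1ℚ) y)      ≡⟨ List.++-assoc x y _ ⟨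
  (x ++ y) ++ scale (- 1ℚ) y      ≈⟨ ++-cong x+y≈0 ≈-refl ⟩
  scale (- 1ℚ) y                  ∎
  where open ≈-Reasoning

record IsLinear (Φ : H → H) : Set where
  field
    cong-≈     : ∀ {x y} → x ≈ y → Φ x ≈ Φ y
    ++-homo    : ∀ x y → Φ (x ++ y) ≈ Φ x ++ Φ y
    []-homo    : Φ [] ≈ []
    scale-homo : ∀ c x → Φ (scale c x) ≈ scale c (Φ x)

  concatMap-homo : ∀ {A : Set} (F : A → H) xs → Φ (concatMap F xs) ≈ concatMap (Φ ∘ F) xs
  concatMap-homo F [] = []-homo
  concatMap-homo F (a ∷ xs) = ≈-trans (++-homo (F a) _) (++-cong ≈-refl (concatMap-homo F xs))

open IsLinear

concatMap-cong-≈ : ∀ {A : Set} {F G : A → H} → (∀ a → F a ≈ G a) → ∀ xs →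
                   concatMap F xs ≈ concatMap G xs
concatMap-cong-≈ F≈G [] = ≈-refl
concatMap-cong-≈ F≈G (a ∷ xs) = ++-cong (F≈G a) (concatMap-cong-≈ F≈G xs)

concatMap-++-≈ : ∀ {A : Set} (F G : A → H) xs →
                 concatMap (λ a → F a ++ G a) xs ≈ concatMap F xs ++ concatMap G xs
concatMap-++-≈ F G [] = ≈-refl
concatMap-++-≈ F G (a ∷ xs) =
  ≈-trans (++-cong {F a ++ G a} ≈-refl (concatMap-++-≈ F G xs)) (interchange (F a) (G a) _ _)

scale-isLinear : ∀ c → IsLinear (scale c)
scale-isLinear c = record
  { cong-≈     = scale-cong c
  ; ++-homo    = λ x y → ≡⇒≈ (scale-++ c x y)
  ; []-homo    = ≈-refl
  ; scale-homo = λ d x → ≡⇒≈ (begin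
      scale c (scale d x)  ≡⟨ scale-scale c d x ⟩
      scale (c * d) x      ≡⟨ cong (λ q → scale q x) (ℚ.*-comm c d) ⟩
      scale (d * c) x      ≡⟨ scale-scale d c x ⟨
      scale d (scale c x)  ∎)
  }
  where open ≡-Reasoning

mapWords : (Word → Word) → H → H
mapWords g = map (map₂ g)

infixl 6 _▷_

_▷_ : H → SN → H
z ▷ a = mapWords (_∷ʳ a) z

mapWords-cong : ∀ g {x y} → x ≈ y → mapWords g x ≈ mapWords g y
mapWords-cong g ≈-refl = ≈-refl
mapWords-cong g (≈-sym p) = ≈-sym (mapWords-cong g p)
mapWords-cong g (≈-trans p q) = ≈-trans (mapWords-cong g p) (mapWords-cong g q)
mapWords-cong g (++-cong {x} {x′} {y} {y′} p q) =
  ≈-trans (≡⇒≈ (List.map-++ _ x y))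
    (≈-trans (++-cong (mapWords-cong g p) (mapWords-cong g q)) (≡⇒≈ (sym (List.map-++ _ x′ y′))))
mapWords-cong g (++-comm x y) =
  ≈-trans (≡⇒≈ (List.map-++ _ x y))
    (≈-trans (++-comm (mapWords g x) (mapWords g y)) (≡⇒≈ (sym (List.map-++ _ y x))))
mapWords-cong g (merge c d w) = merge c d (g w)
mapWords-cong g (drop-0 w) = drop-0 (g w)

mapWords-scale : ∀ g c x → mapWords g (scale c x) ≡ scale c (mapWords g x)
mapWords-scale g c [] = refl
mapWords-scale g c (_ ∷ x) = cong (_ ∷_) (mapWords-scale g c x)

mapWords-isLinear : ∀ g → IsLinear (mapWords g)
mapWords-isLinear g = record
  { cong-≈     = mapWords-cong g
  ; ++-homo    = λ x y → ≡⇒≈ (List.map-++ _ x y)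
  ; []-homo    = ≈-refl
  ; scale-homo = λ c x → ≡⇒≈ (mapWords-scale g c x)
  }

▷-isLinear : ∀ a → IsLinear (_▷ a)
▷-isLinear a = mapWords-isLinear (_∷ʳ a)

extend : (Word → H) → H → H
extend G = concatMap (λ cv → scale (proj₁ cv) (G (proj₂ cv)))

extend-++ : ∀ G x y → extend G (x ++ y) ≡ extend G x ++ extend G y
extend-++ G = List.concatMap-++ _

extend-cong : ∀ G {x y} → x ≈ y → extend G x ≈ extend G y
extend-cong G ≈-refl = ≈-refl
extend-cong G (≈-sym p) = ≈-sym (extend-cong G p)
extend-cong G (≈-trans p q) = ≈-trans (extend-cong G p) (extend-cong G q)
extend-cong G (++-cong {x} {x′} {y} {y′} p q) =
  ≈-trans (≡⇒≈ (extend-++ G x y))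
    (≈-trans (++-cong (extend-cong G p) (extend-cong G q)) (≡⇒≈ (sym (extend-++ G x′ y′))))
extend-cong G (++-comm x y) =
  ≈-trans (≡⇒≈ (extend-++ G x y))
    (≈-trans (++-comm (extend G x) (extend G y)) (≡⇒≈ (sym (extend-++ G y x))))
extend-cong G (merge c d w) =
  ≈-trans (++-cong {scale c (G w)} ≈-refl (≡⇒≈ (List.++-identityʳ _)))
    (≈-trans (scale-+ c d (G w)) (≡⇒≈ (sym (List.++-identityʳ _))))
extend-cong G (drop-0 w) = ≈-trans (≡⇒≈ (List.++-identityʳ _)) (scale-0 (G w))

extend-scale : ∀ G c x → extend G (scale c x) ≈ scale c (extend G x)
extend-scale G c [] = ≈-refl
extend-scale G c ((e , w) ∷ x) =
  ≈-trans (++-cong (≡⇒≈ (sym (scale-scale c e (G w)))) (extend-scale G c x))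
    (≡⇒≈ (sym (scale-++ c (scale e (G w)) _)))

extend-isLinear : ∀ G → IsLinear (extend G)
extend-isLinear G = record
  { cong-≈     = extend-cong G
  ; ++-homo    = λ x y → ≡⇒≈ (extend-++ G x y)
  ; []-homo    = ≈-refl
  ; scale-homo = extend-scale G
  }

extend-word : ∀ G v → extend G (word v) ≈ G v
extend-word G v = ≡⇒≈ (trans (List.++-identityʳ _) (scale-1 (G v)))

extend-word-id : ∀ x → extend word x ≈ x
extend-word-id [] = ≈-refl
extend-word-id ((c , w) ∷ x) =
  ++-cong (≡⇒≈ (cong (λ q → [ (q , w) ]) (ℚ.*-identityʳ c))) (extend-word-id x)

extend-congˡ : ∀ {G G′} → (∀ v → G v ≈ G′ v) → ∀ x → extend G x ≈ extend G′ x
extend-congˡ G≈G′ = concatMap-cong-≈ (λ cv → scale-cong (proj₁ cv) (G≈G′ (proj₂ cv)))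

extend-++ᶠ : ∀ G G′ x → extend (λ v → G v ++ G′ v) x ≈ extend G x ++ extend G′ x
extend-++ᶠ G G′ x =
  ≈-trans (concatMap-cong-≈ (λ cv → ≡⇒≈ (scale-++ (proj₁ cv) (G (proj₂ cv)) (G′ (proj₂ cv)))) x)
    (concatMap-++-≈ _ _ x)

extend-mapWords : ∀ G g x → extend G (mapWords g x) ≡ extend (G ∘ g) x
extend-mapWords G g = List.concatMap-map _ _

linear∘extend : ∀ {Φ} → IsLinear Φ → ∀ G x → Φ (extend G x) ≈ extend (Φ ∘ G) x
linear∘extend L G x =
  ≈-trans (concatMap-homo L _ x) (concatMap-cong-≈ (λ cv → scale-homo L (proj₁ cv) _) x)

-- Sums over the splittings w = α₁α₂

Σsplits : Word → (Word → Word → H) → H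
Σsplits w F = concatMap (uncurry F) (splits w)

Σsplits-∷ : ∀ x v F → Σsplits (x ∷ v) F ≡ F [] (x ∷ v) ++ Σsplits v (λ p q → F (x ∷ p) q)
Σsplits-∷ x v F = cong (F [] (x ∷ v) ++_) (List.concatMap-map (uncurry F) _ (splits v))

Σsplits-∷ʳ : ∀ v y F → Σsplits (v ∷ʳ y) F ≡ Σsplits v (λ p q → F p (q ∷ʳ y)) ++ F (v ∷ʳ y) []
Σsplits-∷ʳ [] y F = begin
  F [] [ y ] ++ F [ y ] [] ++ []    ≡⟨ cong (F [] [ y ] ++_) (List.++-identityʳ _) ⟩
  F [] [ y ] ++ F [ y ] []          ≡⟨ cong (_++ F [ y ] []) (List.++-identityʳ _) ⟨
  (F [] [ y ] ++ []) ++ F [ y ] []  ∎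
  where open ≡-Reasoning
Σsplits-∷ʳ (x ∷ v) y F = begin
  Σsplits (x ∷ v ∷ʳ y) F                         ≡⟨ Σsplits-∷ x (v ∷ʳ y) F ⟩
  F [] (x ∷ v ∷ʳ y) ++ Σsplits (v ∷ʳ y) F′       ≡⟨ cong (F [] (x ∷ v ∷ʳ y) ++_) (Σsplits-∷ʳ v y F′) ⟩
  F [] (x ∷ v ∷ʳ y) ++ (Σsplits v F″ ++ F (x ∷ v ∷ʳ y) [])
                                                 ≡⟨ List.++-assoc (F [] (x ∷ v ∷ʳ y)) _ _ ⟨
  (F [] (x ∷ v ∷ʳ y) ++ Σsplits v F″) ++ F (x ∷ v ∷ʳ y) []
                                                 ≡⟨ cong (_++ F (x ∷ v ∷ʳ y) []) (Σsplits-∷ x v _) ⟨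
  Σsplits (x ∷ v) (λ p q → F p (q ∷ʳ y)) ++ F (x ∷ v ∷ʳ y) [] ∎
  where
  open ≡-Reasoning
  F′ = λ p q → F (x ∷ p) q
  F″ = λ p q → F′ p (q ∷ʳ y)

Σsplits-cong : ∀ v {F G} → (∀ p q → p ++ q ≡ v → F p q ≈ G p q) → Σsplits v F ≈ Σsplits v G
Σsplits-cong [] F≈G = ++-cong (F≈G [] [] refl) ≈-refl
Σsplits-cong (x ∷ v) {F} {G} F≈G = begin
  Σsplits (x ∷ v) F                           ≡⟨ Σsplits-∷ x v F ⟩
  F [] (x ∷ v) ++ Σsplits v (λ p → F (x ∷ p))
    ≈⟨ ++-cong (F≈G [] (x ∷ v) refl) (Σsplits-cong v (λ p q e → F≈G (x ∷ p) q (cong (x ∷_) e))) ⟩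
  G [] (x ∷ v) ++ Σsplits v (λ p → G (x ∷ p)) ≡⟨ Σsplits-∷ x v G ⟨
  Σsplits (x ∷ v) G                           ∎
  where open ≈-Reasoning

Σsplits-++ : ∀ v F G → Σsplits v (λ p q → F p q ++ G p q) ≈ Σsplits v F ++ Σsplits v G
Σsplits-++ v F G = concatMap-++-≈ (uncurry F) (uncurry G) (splits v)

Σsplits-homo : ∀ {Φ} → IsLinear Φ → ∀ v F → Φ (Σsplits v F) ≈ Σsplits v (λ p q → Φ (F p q))
Σsplits-homo L v F = concatMap-homo L (uncurry F) (splits v)

Σsplits-last : ∀ v F → (∀ p r → p ++ r ≡ v → r ≢ [] → F p r ≈ []) → Σsplits v F ≈ F v []
Σsplits-last [] F _ = ≡⇒≈ (List.++-identityʳ _)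
Σsplits-last (x ∷ v) F F≈0 = begin
  Σsplits (x ∷ v) F                           ≡⟨ Σsplits-∷ x v F ⟩
  F [] (x ∷ v) ++ Σsplits v (λ p → F (x ∷ p))
    ≈⟨ ++-cong (F≈0 [] (x ∷ v) refl λ ()) (Σsplits-last v _ λ p r e → F≈0 (x ∷ p) r (cong (x ∷_) e)) ⟩
  F (x ∷ v) []                                ∎
  where open ≈-Reasoning

Σsplits-assoc : ∀ v (K : Word → Word → Word → H) →
  Σsplits v (λ a b → Σsplits a (λ p q → K p q b)) ≈ Σsplits v (λ p r → Σsplits r (λ q b → K p q b))
Σsplits-assoc [] K = ≈-refl
Σsplits-assoc (x ∷ v) K = begin
  Σsplits (x ∷ v) (λ a b → Σsplits a (λ p q → K p q b))
    ≡⟨ Σsplits-∷ x v _ ⟩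
  (K₀ ++ []) ++ Σsplits v (λ a b → Σsplits (x ∷ a) (λ p q → K p q b))
    ≈⟨ ++-cong (≡⇒≈ (List.++-identityʳ K₀)) (Σsplits-cong v λ a b _ → ≡⇒≈ (Σsplits-∷ x a _)) ⟩
  K₀ ++ Σsplits v (λ a b → K [] (x ∷ a) b ++ Σsplits a (λ p q → K (x ∷ p) q b))
    ≈⟨ ++-cong {K₀} ≈-refl (Σsplits-++ v _ _) ⟩
  K₀ ++ Σsplits v (λ a → K [] (x ∷ a)) ++ Σsplits v (λ a b → Σsplits a (λ p q → K (x ∷ p) q b))
    ≡⟨ List.++-assoc K₀ _ _ ⟨
  (K₀ ++ Σsplits v (λ a → K [] (x ∷ a))) ++ Σsplits v (λ a b → Σsplits a (λ p q → K (x ∷ p) q b))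
    ≈⟨ ++-cong (≡⇒≈ (sym (Σsplits-∷ x v (K [])))) (Σsplits-assoc v (λ p → K (x ∷ p))) ⟩
  Σsplits (x ∷ v) (K []) ++ Σsplits v (λ p r → Σsplits r (K (x ∷ p)))
    ≡⟨ Σsplits-∷ x v _ ⟨
  Σsplits (x ∷ v) (λ p r → Σsplits r (λ q b → K p q b)) ∎
  where
  open ≈-Reasoning
  K₀ = K [] [] (x ∷ v)

-- Associativity of S_ℕ

-- Under coefficients, ⊕ becomes pointwise addition of coefficient lists, the
-- shorter one padded with zeros.
coefficients : SN → List ℕ
coefficients (mk xs k) = xs ∷ʳ suc k

infixl 6 _⊞_

_⊞_ : List ℕ → List ℕ → List ℕ
[] ⊞ ys = ys
(x ∷ xs) ⊞ [] = x ∷ xs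
(x ∷ xs) ⊞ (y ∷ ys) = x ℕ.+ y ∷ xs ⊞ ys

⊞-identityʳ : ∀ xs → xs ⊞ [] ≡ xs
⊞-identityʳ [] = refl
⊞-identityʳ (x ∷ xs) = refl

⊞-assoc : ∀ xs ys zs → (xs ⊞ ys) ⊞ zs ≡ xs ⊞ (ys ⊞ zs)
⊞-assoc [] ys zs = refl
⊞-assoc (x ∷ xs) [] zs = refl
⊞-assoc (x ∷ xs) (y ∷ ys) [] = refl
⊞-assoc (x ∷ xs) (y ∷ ys) (z ∷ zs) = cong₂ _∷_ (ℕ.+-assoc x y z) (⊞-assoc xs ys zs)

coefficients-⊕ : ∀ a b → coefficients (a ⊕ b) ≡ coefficients a ⊞ coefficients b
coefficients-⊕ (mk [] a) (mk [] b) = cong (λ n → [ suc n ]) (sym (ℕ.+-suc a b))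
coefficients-⊕ (mk [] a) (mk (y ∷ ys) b) = refl
coefficients-⊕ (mk (x ∷ xs) a) (mk [] b) = cong (x ℕ.+ suc b ∷_) (sym (⊞-identityʳ (xs ∷ʳ suc a)))
coefficients-⊕ (mk (x ∷ xs) a) (mk (y ∷ ys) b) = cong (x ℕ.+ y ∷_) (coefficients-⊕ (mk xs a) (mk ys b))

coefficients-injective : ∀ {a b} → coefficients a ≡ coefficients b → a ≡ b
coefficients-injective {mk xs a} {mk ys b} eq with List.∷ʳ-injective xs ys eq
... | refl , refl = refl

⊕-assoc : ∀ a b c → (a ⊕ b) ⊕ c ≡ a ⊕ (b ⊕ c)
⊕-assoc a b c = coefficients-injective (begin
  coefficients ((a ⊕ b) ⊕ c)                            ≡⟨ coefficients-⊕ (a ⊕ b) c ⟩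
  coefficients (a ⊕ b) ⊞ coefficients c                 ≡⟨ cong (_⊞ coefficients c) (coefficients-⊕ a b) ⟩
  coefficients a ⊞ coefficients b ⊞ coefficients c      ≡⟨ ⊞-assoc (coefficients a) (coefficients b) (coefficients c) ⟩
  coefficients a ⊞ (coefficients b ⊞ coefficients c)    ≡⟨ cong (coefficients a ⊞_) (coefficients-⊕ b c) ⟨
  coefficients a ⊞ coefficients (b ⊕ c)                 ≡⟨ coefficients-⊕ a (b ⊕ c) ⟨
  coefficients (a ⊕ (b ⊕ c))                            ∎)
  where open ≡-Reasoning

∣∣-∷ʳ : ∀ x p y → ∣ x ∷ (p ∷ʳ y) ∣ ≡ ∣ x ∷ p ∣ ⊕ y
∣∣-∷ʳ x [] y = refl
∣∣-∷ʳ x (z ∷ p) y = trans (cong (x ⊕_) (∣∣-∷ʳ z p y)) (sym (⊕-assoc x ∣ z ∷ p ∣ y))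

-- The harmonic product with a word

infixl 7 _⋆ʷ_

_⋆ʷ_ : H → Word → H
x ⋆ʷ β = extend (λ v → starW v β) x

⋆-word : ∀ x β → x ⋆ word β ≡ x ⋆ʷ β
⋆-word [] β = refl
⋆-word ((c , v) ∷ x) β = cong₂ _++_
  (trans (List.++-identityʳ _) (cong (λ q → scale q (starW v β)) (ℚ.*-identityʳ c)))
  (⋆-word x β)

starRev-[]ʳ : ∀ r → starRev r [] ≡ [ r ]
starRev-[]ʳ [] = refl
starRev-[]ʳ (x ∷ r) = refl

reversedTerm : Word → ℚ × Word
reversedTerm v = (1ℚ , reverse v)

starW-[]ʳ : ∀ v → starW v [] ≡ word v
starW-[]ʳ v = trans (cong (map reversedTerm) (starRev-[]ʳ (reverse v)))
                    (cong (λ r → [ (1ℚ , r) ]) (List.reverse-involutive v))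

starW-[]ˡ : ∀ β → starW [] β ≡ word β
starW-[]ˡ β = cong (λ r → [ (1ℚ , r) ]) (List.reverse-involutive β)

reversedTerms-∷ : ∀ a S → map reversedTerm (map (a ∷_) S) ≡ map reversedTerm S ▷ a
reversedTerms-∷ a [] = refl
reversedTerms-∷ a (v ∷ S) =
  cong₂ _∷_ (cong (1ℚ ,_) (List.unfold-reverse a v)) (reversedTerms-∷ a S)

-- The recursion defining the harmonic product, recovered from starRev.
starW-∷ʳ : ∀ γ a β y →
  starW (γ ∷ʳ a) (β ∷ʳ y) ≡ starW γ (β ∷ʳ y) ▷ a ++ starW (γ ∷ʳ a) β ▷ y ++ starW γ β ▷ (a ⊕ y)
starW-∷ʳ γ a β y = begin
  starW (γ ∷ʳ a) (β ∷ʳ y)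
    ≡⟨ cong₂ (λ r t → ⟪ starRev r t ⟫) (List.reverse-++ γ [ a ]) (List.reverse-++ β [ y ]) ⟩
  ⟪ map (a ∷_) S₁ ++ map (y ∷_) S₂ ++ map (a ⊕ y ∷_) S₃ ⟫
    ≡⟨ trans (List.map-++ reversedTerm (map (a ∷_) S₁) _)
             (cong (⟪ map (a ∷_) S₁ ⟫ ++_) (List.map-++ reversedTerm (map (y ∷_) S₂) _)) ⟩
  ⟪ map (a ∷_) S₁ ⟫ ++ ⟪ map (y ∷_) S₂ ⟫ ++ ⟪ map (a ⊕ y ∷_) S₃ ⟫
    ≡⟨ cong₂ _++_ (reversedTerms-∷ a S₁) (cong₂ _++_ (reversedTerms-∷ y S₂) (reversedTerms-∷ (a ⊕ y) S₃)) ⟩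
  ⟪ S₁ ⟫ ▷ a ++ ⟪ S₂ ⟫ ▷ y ++ ⟪ S₃ ⟫ ▷ (a ⊕ y)
    ≡⟨ cong₂ (λ r t → ⟪ starRev γ′ r ⟫ ▷ a ++ ⟪ starRev t β′ ⟫ ▷ y ++ ⟪ S₃ ⟫ ▷ (a ⊕ y))
             (List.reverse-++ β [ y ]) (List.reverse-++ γ [ a ]) ⟨
  starW γ (β ∷ʳ y) ▷ a ++ starW (γ ∷ʳ a) β ▷ y ++ starW γ β ▷ (a ⊕ y) ∎
  where
  open ≡-Reasoning
  ⟪_⟫ : List Word → H
  ⟪_⟫ = map reversedTerm
  γ′ = reverse γ
  β′ = reverse β
  S₁ = starRev γ′ (y ∷ β′)
  S₂ = starRev (a ∷ γ′) β′
  S₃ = starRev γ′ β′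

⋆ʷ-[] : ∀ x → x ⋆ʷ [] ≈ x
⋆ʷ-[] x = ≈-trans (extend-congˡ (λ v → ≡⇒≈ (starW-[]ʳ v)) x) (extend-word-id x)

word[]-⋆ʷ : ∀ β → word [] ⋆ʷ β ≈ word β
word[]-⋆ʷ β = ≈-trans (extend-word (λ v → starW v β) []) (≡⇒≈ (starW-[]ˡ β))

▷-⋆ʷ-∷ʳ : ∀ z a β y →
  (z ▷ a) ⋆ʷ (β ∷ʳ y) ≈ z ⋆ʷ (β ∷ʳ y) ▷ a ++ (z ▷ a) ⋆ʷ β ▷ y ++ z ⋆ʷ β ▷ (a ⊕ y)
▷-⋆ʷ-∷ʳ z a β y = begin
  (z ▷ a) ⋆ʷ (β ∷ʳ y)
    ≡⟨ extend-mapWords _ _ z ⟩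
  extend (λ γ → starW (γ ∷ʳ a) (β ∷ʳ y)) z
    ≈⟨ extend-congˡ (λ γ → ≡⇒≈ (starW-∷ʳ γ a β y)) z ⟩
  extend (λ γ → starW γ (β ∷ʳ y) ▷ a ++ starW (γ ∷ʳ a) β ▷ y ++ starW γ β ▷ (a ⊕ y)) z
    ≈⟨ ≈-trans (extend-++ᶠ _ _ z) (++-cong ≈-refl (extend-++ᶠ _ _ z)) ⟩
  extend (λ γ → starW γ (β ∷ʳ y) ▷ a) z ++ extend (λ γ → starW (γ ∷ʳ a) β ▷ y) z
    ++ extend (λ γ → starW γ β ▷ (a ⊕ y)) z
    ≈⟨ ++-cong (≈-sym (linear∘extend (▷-isLinear a) _ z))
         (++-cong (≈-sym (linear∘extend (▷-isLinear y) _ z)) (≈-sym (linear∘extend (▷-isLinear (a ⊕ y)) _ z))) ⟩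
  z ⋆ʷ (β ∷ʳ y) ▷ a ++ extend (λ γ → starW (γ ∷ʳ a) β) z ▷ y ++ z ⋆ʷ β ▷ (a ⊕ y)
    ≡⟨ cong (λ t → z ⋆ʷ (β ∷ʳ y) ▷ a ++ t ▷ y ++ z ⋆ʷ β ▷ (a ⊕ y)) (sym (extend-mapWords _ _ z)) ⟩
  z ⋆ʷ (β ∷ʳ y) ▷ a ++ (z ▷ a) ⋆ʷ β ▷ y ++ z ⋆ʷ β ▷ (a ⊕ y) ∎
  where open ≈-Reasoning

-- The recursion for f along the first letter

addToFirst : SN → Word → Word
addToFirst x [] = []
addToFirst x (a ∷ r) = x ⊕ a ∷ r

addToLast : SN → Word → Word
addToLast x v = reverse (addToFirst x (reverse v))

addToLast-∷ʳ : ∀ x v a → addToLast x (v ∷ʳ a) ≡ v ∷ʳ (x ⊕ a)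
addToLast-∷ʳ x v a = begin
  reverse (addToFirst x (reverse (v ∷ʳ a)))  ≡⟨ cong (reverse ∘ addToFirst x) (List.reverse-++ v [ a ]) ⟩
  reverse (x ⊕ a ∷ reverse v)                ≡⟨ List.unfold-reverse (x ⊕ a) (reverse v) ⟩
  reverse (reverse v) ∷ʳ (x ⊕ a)             ≡⟨ cong (_∷ʳ (x ⊕ a)) (List.reverse-involutive v) ⟩
  v ∷ʳ (x ⊕ a)                               ∎
  where open ≡-Reasoning

addToLast-▷ : ∀ x z a → mapWords (addToLast x) (z ▷ a) ≡ z ▷ (x ⊕ a)
addToLast-▷ x [] a = refl
addToLast-▷ x ((c , v) ∷ z) a = cong₂ _∷_ (cong (c ,_) (addToLast-∷ʳ x v a)) (addToLast-▷ x z a)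

-- Rev lists the block sums with the first block last, so a new first letter
-- either opens a new block (▷ x) or joins the first block (addToLast x).
blockTerm : List⁺ (List⁺ SN) → ℚ × Word
blockTerm bs = (1ℚ , Rev (map ∣_∣ (toList bs)))

blockTerms-new : ∀ x D → map blockTerm (map ((x ∷ []) ∷⁺_) D) ≡ map blockTerm D ▷ x
blockTerms-new x [] = refl
blockTerms-new x (bs ∷ D) =
  cong₂ _∷_ (cong (1ℚ ,_) (List.unfold-reverse x (map ∣_∣ (toList bs)))) (blockTerms-new x D)

blockTerms-join : ∀ x D → map blockTerm (map (λ { (b ∷ bs) → (x ∷⁺ b) ∷ bs }) D)
                          ≡ mapWords (addToLast x) (map blockTerm D)
blockTerms-join x [] = refl
blockTerms-join x ((b ∷ bs) ∷ D) = cong₂ _∷_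
  (cong (λ t → (1ℚ , reverse (addToFirst x t))) (sym (List.reverse-involutive (map ∣_∣ (b ∷ bs)))))
  (blockTerms-join x D)

f-∷-∷ : ∀ x y ys → f (x ∷ y ∷ ys) ≡ f (y ∷ ys) ▷ x ++ mapWords (addToLast x) (f (y ∷ ys))
f-∷-∷ x y ys = trans
  (List.map-++ blockTerm (map ((x ∷ []) ∷⁺_) (decomps y ys)) _)
  (cong₂ _++_ (blockTerms-new x (decomps y ys)) (blockTerms-join x (decomps y ys)))

f-∷ : ∀ x xs → f (x ∷ xs) ≈ Σsplits xs (λ p q → f q ▷ ∣ x ∷ p ∣)
f-∷ x [] = ≈-refl
f-∷ x (y ∷ ys) = begin
  f (x ∷ y ∷ ys)
    ≡⟨ f-∷-∷ x y ys ⟩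
  f (y ∷ ys) ▷ x ++ mapWords (addToLast x) (f (y ∷ ys))
    ≈⟨ ++-cong ≈-refl (mapWords-cong (addToLast x) (f-∷ y ys)) ⟩
  f (y ∷ ys) ▷ x ++ mapWords (addToLast x) (Σsplits ys (λ p q → f q ▷ ∣ y ∷ p ∣))
    ≈⟨ ++-cong ≈-refl (Σsplits-homo (mapWords-isLinear (addToLast x)) ys _) ⟩
  f (y ∷ ys) ▷ x ++ Σsplits ys (λ p q → mapWords (addToLast x) (f q ▷ ∣ y ∷ p ∣))
    ≈⟨ ++-cong ≈-refl (Σsplits-cong ys λ p q _ → ≡⇒≈ (addToLast-▷ x (f q) ∣ y ∷ p ∣)) ⟩
  f (y ∷ ys) ▷ x ++ Σsplits ys (λ p q → f q ▷ ∣ x ∷ y ∷ p ∣)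
    ≡⟨ Σsplits-∷ y ys _ ⟨
  Σsplits (y ∷ ys) (λ p q → f q ▷ ∣ x ∷ p ∣) ∎
  where open ≈-Reasoning

sgn : Word → ℚ
sgn w = sign (length w)

sign-+ : ∀ m n → sign (m ℕ.+ n) ≡ sign m * sign n
sign-+ zero n = sym (ℚ.*-identityˡ _)
sign-+ (suc m) n = trans (cong -_ (sign-+ m n)) (ℚ.neg-distribˡ-* (sign m) (sign n))

sgn-++ : ∀ p q → sgn (p ++ q) ≡ sgn p * sgn q
sgn-++ p q = trans (cong sign (List.length-++ p)) (sign-+ (length p) (length q))

sgn-∷ʳ : ∀ u y → sgn (u ∷ʳ y) ≡ - sgn u
sgn-∷ʳ [] y = refl
sgn-∷ʳ (x ∷ u) y = cong -_ (sgn-∷ʳ u y)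

-1*sgn-∷ʳ : ∀ u y → - 1ℚ * sgn (u ∷ʳ y) ≡ sgn u
-1*sgn-∷ʳ [] y = refl
-1*sgn-∷ʳ (x ∷ u) y = trans (sym (ℚ.neg-distribʳ-* (- 1ℚ) (sgn (u ∷ʳ y)))) (cong -_ (-1*sgn-∷ʳ u y))

-- The left-hand side and its recursion along the last letter

term : Word → Word → H
term a b = scale (sgn a) (f a ⋆ʷ b)

lhs′ : Word → H
lhs′ w = Σsplits w term

lhs≈lhs′ : ∀ w → lhs w ≈ lhs′ w
lhs≈lhs′ w = concatMap-cong-≈
  (λ ab → ≡⇒≈ (cong (scale (sgn (proj₁ ab))) (⋆-word (f (proj₁ ab)) (proj₂ ab)))) (splits w)

lhs′-[] : lhs′ [] ≈ word []
lhs′-[] = ≈-trans (≡⇒≈ (trans (List.++-identityʳ _) (scale-1 _))) (word[]-⋆ʷ [])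

lhs′-[_] : ∀ y → lhs′ [ y ] ≈ []
lhs′-[ y ] = begin
  term [] [ y ] ++ term [ y ] [] ++ []
    ≡⟨ cong (term [] [ y ] ++_) (List.++-identityʳ _) ⟩
  term [] [ y ] ++ term [ y ] []
    ≈⟨ ++-cong (scale-cong 1ℚ (word[]-⋆ʷ [ y ])) (scale-cong (- 1ℚ) (⋆ʷ-[] (word [ y ]))) ⟩
  scale 1ℚ (word [ y ]) ++ scale (- 1ℚ) (word [ y ])
    ≈⟨ scale-cancel 1ℚ (word [ y ]) ⟩
  [] ∎
  where open ≈-Reasoning

-- The terms of f a ⋆ (b y) whose last letter is not y by itself.
mixed : Word → Word → SN → H
mixed [] b y = []
mixed (x ∷ a) b y = Σsplits a (λ p q → f q ⋆ʷ (b ∷ʳ y) ▷ ∣ x ∷ p ∣ ++ f q ⋆ʷ b ▷ (∣ x ∷ p ∣ ⊕ y))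

f⋆ʷ-∷ʳ : ∀ a b y → f a ⋆ʷ (b ∷ʳ y) ≈ f a ⋆ʷ b ▷ y ++ mixed a b y
f⋆ʷ-∷ʳ [] b y = ≈-trans (word[]-⋆ʷ (b ∷ʳ y))
  (≈-sym (≈-trans (≡⇒≈ (List.++-identityʳ _)) (mapWords-cong (_∷ʳ y) (word[]-⋆ʷ b))))
f⋆ʷ-∷ʳ (x ∷ a) b y = begin
  f (x ∷ a) ⋆ʷ (b ∷ʳ y)                      ≈⟨ extend-cong _ (f-∷ x a) ⟩
  Σsplits a G ⋆ʷ (b ∷ʳ y)                    ≈⟨ Σsplits-homo (extend-isLinear _) a G ⟩
  Σsplits a (λ p q → G p q ⋆ʷ (b ∷ʳ y))      ≈⟨ Σsplits-cong a (λ p q _ → ▷-⋆ʷ-∷ʳ (f q) ∣ x ∷ p ∣ b y) ⟩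
  Σsplits a (λ p q → A p q ++ B p q ++ C p q) ≈⟨ Σsplits-cong a (λ p q _ → x∙yz≈y∙xz (A p q) (B p q) (C p q)) ⟩
  Σsplits a (λ p q → B p q ++ A p q ++ C p q) ≈⟨ Σsplits-++ a B _ ⟩
  Σsplits a B ++ mixed (x ∷ a) b y           ≈⟨ ++-cong ΣB ≈-refl ⟩
  f (x ∷ a) ⋆ʷ b ▷ y ++ mixed (x ∷ a) b y    ∎
  where
  open ≈-Reasoning
  G A B C : Word → Word → H
  G p q = f q ▷ ∣ x ∷ p ∣
  A p q = f q ⋆ʷ (b ∷ʳ y) ▷ ∣ x ∷ p ∣
  B p q = G p q ⋆ʷ b ▷ y
  C p q = f q ⋆ʷ b ▷ (∣ x ∷ p ∣ ⊕ y)
  ΣB : Σsplits a B ≈ f (x ∷ a) ⋆ʷ b ▷ y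
  ΣB = begin
    Σsplits a B                              ≈⟨ Σsplits-homo (▷-isLinear y) a _ ⟨
    Σsplits a (λ p q → G p q ⋆ʷ b) ▷ y       ≈⟨ mapWords-cong _ (Σsplits-homo (extend-isLinear _) a G) ⟨
    Σsplits a G ⋆ʷ b ▷ y                     ≈⟨ mapWords-cong _ (extend-cong _ (f-∷ x a)) ⟨
    f (x ∷ a) ⋆ʷ b ▷ y                       ∎

mixedSum : Word → SN → H
mixedSum v y = Σsplits v (λ a b → scale (sgn a) (mixed a b y))

lhs′-∷ʳ : ∀ v y → lhs′ (v ∷ʳ y) ≈ lhs′ v ▷ y ++ mixedSum v y ++ term (v ∷ʳ y) []
lhs′-∷ʳ v y = begin
  lhs′ (v ∷ʳ y)
    ≡⟨ Σsplits-∷ʳ v y term ⟩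
  Σsplits v (λ a b → term a (b ∷ʳ y)) ++ term (v ∷ʳ y) []
    ≈⟨ ++-cong (Σsplits-cong v λ a b _ → term-∷ʳ a b) ≈-refl ⟩
  Σsplits v (λ a b → term a b ▷ y ++ scale (sgn a) (mixed a b y)) ++ term (v ∷ʳ y) []
    ≈⟨ ++-cong (≈-trans (Σsplits-++ v _ _)
                        (++-cong (≈-sym (Σsplits-homo (▷-isLinear y) v term)) ≈-refl)) ≈-refl ⟩
  (lhs′ v ▷ y ++ mixedSum v y) ++ term (v ∷ʳ y) []
    ≡⟨ List.++-assoc (lhs′ v ▷ y) _ _ ⟩
  lhs′ v ▷ y ++ mixedSum v y ++ term (v ∷ʳ y) [] ∎
  where
  open ≈-Reasoning
  term-∷ʳ : ∀ a b → term a (b ∷ʳ y) ≈ term a b ▷ y ++ scale (sgn a) (mixed a b y)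
  term-∷ʳ a b = ≈-trans (scale-cong (sgn a) (f⋆ʷ-∷ʳ a b y))
    (≡⇒≈ (trans (scale-++ (sgn a) (f a ⋆ʷ b ▷ y) (mixed a b y))
                 (cong (_++ scale (sgn a) (mixed a b y)) (sym (mapWords-scale (_∷ʳ y) (sgn a) (f a ⋆ʷ b))))))

-- The induction step

lhs′-butLast : Word → SN → H
lhs′-butLast r y = Σsplits r (λ q b → term q (b ∷ʳ y))

Σsplits-term-▷ : ∀ r y c d →
  Σsplits r (λ q b → scale (sgn q) (f q ⋆ʷ (b ∷ʳ y) ▷ c ++ f q ⋆ʷ b ▷ d))
    ≈ lhs′-butLast r y ▷ c ++ lhs′ r ▷ d
Σsplits-term-▷ r y c d = begin
  Σsplits r (λ q b → scale (sgn q) (f q ⋆ʷ (b ∷ʳ y) ▷ c ++ f q ⋆ʷ b ▷ d))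
    ≈⟨ Σsplits-cong r (λ q b _ → ≡⇒≈ (trans (scale-++ (sgn q) (f q ⋆ʷ (b ∷ʳ y) ▷ c) (f q ⋆ʷ b ▷ d))
         (cong₂ _++_ (sym (mapWords-scale (_∷ʳ c) (sgn q) (f q ⋆ʷ (b ∷ʳ y))))
                     (sym (mapWords-scale (_∷ʳ d) (sgn q) (f q ⋆ʷ b)))))) ⟩
  Σsplits r (λ q b → term q (b ∷ʳ y) ▷ c ++ term q b ▷ d)
    ≈⟨ Σsplits-++ r _ _ ⟩
  Σsplits r (λ q b → term q (b ∷ʳ y) ▷ c) ++ Σsplits r (λ q b → term q b ▷ d)
    ≈⟨ ++-cong (Σsplits-homo (▷-isLinear c) r _) (Σsplits-homo (▷-isLinear d) r term) ⟨
  lhs′-butLast r y ▷ c ++ lhs′ r ▷ d ∎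
  where open ≈-Reasoning

mixedSum-∷ : ∀ x v y → mixedSum (x ∷ v) y ≈
  Σsplits v (λ p r → scale (sgn (x ∷ p)) (lhs′-butLast r y ▷ ∣ x ∷ p ∣ ++ lhs′ r ▷ (∣ x ∷ p ∣ ⊕ y)))
mixedSum-∷ x v y = begin
  mixedSum (x ∷ v) y
    ≡⟨ Σsplits-∷ x v (λ a b → scale (sgn a) (mixed a b y)) ⟩
  Σsplits v (λ a b → scale (sgn (x ∷ a)) (Σsplits a (λ p q → Y p q b)))
    ≈⟨ Σsplits-cong v (λ a b _ → Σsplits-homo (scale-isLinear (sgn (x ∷ a))) a _) ⟩
  Σsplits v (λ a b → Σsplits a (λ p q → scale (sgn (x ∷ a)) (Y p q b)))
    ≈⟨ Σsplits-cong v (λ a b _ → Σsplits-cong a λ p q p++q≡a → ≡⇒≈ (split-sign a b p q p++q≡a)) ⟩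
  Σsplits v (λ a b → Σsplits a (λ p q → scale (sgn (x ∷ p)) (scale (sgn q) (Y p q b))))
    ≈⟨ Σsplits-assoc v (λ p q b → scale (sgn (x ∷ p)) (scale (sgn q) (Y p q b))) ⟩
  Σsplits v (λ p r → Σsplits r (λ q b → scale (sgn (x ∷ p)) (scale (sgn q) (Y p q b))))
    ≈⟨ Σsplits-cong v (λ p r _ → ≈-trans (≈-sym (Σsplits-homo (scale-isLinear (sgn (x ∷ p))) r _))
                                          (scale-cong (sgn (x ∷ p)) (Σsplits-term-▷ r y _ _))) ⟩
  Σsplits v (λ p r → scale (sgn (x ∷ p)) (lhs′-butLast r y ▷ ∣ x ∷ p ∣ ++ lhs′ r ▷ (∣ x ∷ p ∣ ⊕ y))) ∎
  where
  open ≈-Reasoning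
  Y : Word → Word → Word → H
  Y p q b = f q ⋆ʷ (b ∷ʳ y) ▷ ∣ x ∷ p ∣ ++ f q ⋆ʷ b ▷ (∣ x ∷ p ∣ ⊕ y)
  split-sign : ∀ a b p q → p ++ q ≡ a →
               scale (sgn (x ∷ a)) (Y p q b) ≡ scale (sgn (x ∷ p)) (scale (sgn q) (Y p q b))
  split-sign a b p q refl = trans (cong (λ c → scale c (Y p q b)) (sgn-++ (x ∷ p) q))
                                  (sym (scale-scale (sgn (x ∷ p)) (sgn q) (Y p q b)))

lhs′-butLast≈ : ∀ r y → lhs′ (r ∷ʳ y) ≈ [] →
                  lhs′-butLast r y ≈ scale (sgn r) (f (r ∷ʳ y))
lhs′-butLast≈ r y lhs′≈[] = begin
  lhs′-butLast r y
    ≈⟨ ++≈[]⇒≈-neg (≈-trans (≡⇒≈ (sym (Σsplits-∷ʳ r y term))) lhs′≈[]) ⟩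
  scale (- 1ℚ) (scale (sgn (r ∷ʳ y)) (f (r ∷ʳ y) ⋆ʷ []))
    ≈⟨ scale-cong (- 1ℚ) (scale-cong (sgn (r ∷ʳ y)) (⋆ʷ-[] (f (r ∷ʳ y)))) ⟩
  scale (- 1ℚ) (scale (sgn (r ∷ʳ y)) (f (r ∷ʳ y)))
    ≡⟨ scale-scale (- 1ℚ) (sgn (r ∷ʳ y)) (f (r ∷ʳ y)) ⟩
  scale (- 1ℚ * sgn (r ∷ʳ y)) (f (r ∷ʳ y))
    ≡⟨ cong (λ c → scale c (f (r ∷ʳ y))) (-1*sgn-∷ʳ r y) ⟩
  scale (sgn r) (f (r ∷ʳ y)) ∎
  where open ≈-Reasoning

Σsplits-sgn : ∀ u v (G : Word → Word → H) →
  Σsplits v (λ p r → scale (sgn (u ++ p)) (scale (sgn r) (G p r))) ≈ scale (sgn (u ++ v)) (Σsplits v G)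
Σsplits-sgn u v G = begin
  Σsplits v (λ p r → scale (sgn (u ++ p)) (scale (sgn r) (G p r)))
    ≈⟨ Σsplits-cong v (λ p r p++r≡v → ≡⇒≈ (merge-signs p r p++r≡v)) ⟩
  Σsplits v (λ p r → scale (sgn (u ++ v)) (G p r))
    ≈⟨ Σsplits-homo (scale-isLinear (sgn (u ++ v))) v G ⟨
  scale (sgn (u ++ v)) (Σsplits v G) ∎
  where
  open ≈-Reasoning
  merge-signs : ∀ p r → p ++ r ≡ v →
           scale (sgn (u ++ p)) (scale (sgn r) (G p r)) ≡ scale (sgn (u ++ v)) (G p r)
  merge-signs p r refl = trans (scale-scale (sgn (u ++ p)) (sgn r) (G p r))
    (cong (λ c → scale c (G p r)) (trans (sym (sgn-++ (u ++ p) r)) (cong sgn (List.++-assoc u p r))))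

mixedSum-∷≈ : ∀ x v y →
  (∀ p r → p ++ r ≡ v → lhs′ (r ∷ʳ y) ≈ []) →
  (∀ p r → p ++ r ≡ v → r ≢ [] → lhs′ r ≈ []) →
  mixedSum (x ∷ v) y ≈ scale (sgn (x ∷ v)) (Σsplits (v ∷ʳ y) (λ p q → f q ▷ ∣ x ∷ p ∣))
mixedSum-∷≈ x v y suffix∷ʳ-vanishes suffix-vanishes = begin
  mixedSum (x ∷ v) y
    ≈⟨ mixedSum-∷ x v y ⟩
  Σsplits v (λ p r → scale (sgn (x ∷ p)) (lhs′-butLast r y ▷ ∣ x ∷ p ∣ ++ lhs′ r ▷ (∣ x ∷ p ∣ ⊕ y)))
    ≈⟨ ≈-trans (Σsplits-cong v λ p r _ → ≡⇒≈ (scale-++ (sgn (x ∷ p)) _ (lhs′ r ▷ (∣ x ∷ p ∣ ⊕ y))))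
               (Σsplits-++ v _ _) ⟩
  Σsplits v (λ p r → scale (sgn (x ∷ p)) (lhs′-butLast r y ▷ ∣ x ∷ p ∣))
    ++ Σsplits v (λ p r → scale (sgn (x ∷ p)) (lhs′ r ▷ (∣ x ∷ p ∣ ⊕ y)))
    ≈⟨ ++-cong first-block-ends last-block-ends ⟩
  scale c (Σsplits v (λ p r → f (r ∷ʳ y) ▷ ∣ x ∷ p ∣)) ++ scale c (f [] ▷ ∣ x ∷ (v ∷ʳ y) ∣)
    ≡⟨ trans (cong (scale c) (Σsplits-∷ʳ v y (λ p q → f q ▷ ∣ x ∷ p ∣)))
             (scale-++ c (Σsplits v (λ p r → f (r ∷ʳ y) ▷ ∣ x ∷ p ∣)) (f [] ▷ ∣ x ∷ (v ∷ʳ y) ∣)) ⟨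
  scale c (Σsplits (v ∷ʳ y) (λ p q → f q ▷ ∣ x ∷ p ∣)) ∎
  where
  open ≈-Reasoning
  c = sgn (x ∷ v)
  first-block-ends : Σsplits v (λ p r → scale (sgn (x ∷ p)) (lhs′-butLast r y ▷ ∣ x ∷ p ∣))
                     ≈ scale c (Σsplits v (λ p r → f (r ∷ʳ y) ▷ ∣ x ∷ p ∣))
  first-block-ends = begin
    Σsplits v (λ p r → scale (sgn (x ∷ p)) (lhs′-butLast r y ▷ ∣ x ∷ p ∣))
      ≈⟨ Σsplits-cong v (λ p r p++r≡v → scale-cong (sgn (x ∷ p)) (≈-trans
           (mapWords-cong (_∷ʳ ∣ x ∷ p ∣) (lhs′-butLast≈ r y (suffix∷ʳ-vanishes p r p++r≡v)))
           (≡⇒≈ (mapWords-scale (_∷ʳ ∣ x ∷ p ∣) (sgn r) (f (r ∷ʳ y)))))) ⟩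
    Σsplits v (λ p r → scale (sgn ([ x ] ++ p)) (scale (sgn r) (f (r ∷ʳ y) ▷ ∣ x ∷ p ∣)))
      ≈⟨ Σsplits-sgn [ x ] v (λ p r → f (r ∷ʳ y) ▷ ∣ x ∷ p ∣) ⟩
    scale c (Σsplits v (λ p r → f (r ∷ʳ y) ▷ ∣ x ∷ p ∣)) ∎
  last-block-ends : Σsplits v (λ p r → scale (sgn (x ∷ p)) (lhs′ r ▷ (∣ x ∷ p ∣ ⊕ y)))
                    ≈ scale c (f [] ▷ ∣ x ∷ (v ∷ʳ y) ∣)
  last-block-ends = begin
    Σsplits v (λ p r → scale (sgn (x ∷ p)) (lhs′ r ▷ (∣ x ∷ p ∣ ⊕ y)))
      ≈⟨ Σsplits-last v _ (λ p r p++r≡v r≢[] → scale-cong (sgn (x ∷ p))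
           (mapWords-cong (_∷ʳ (∣ x ∷ p ∣ ⊕ y)) (suffix-vanishes p r p++r≡v r≢[]))) ⟩
    scale c (lhs′ [] ▷ (∣ x ∷ v ∣ ⊕ y))   ≈⟨ scale-cong c (mapWords-cong (_∷ʳ (∣ x ∷ v ∣ ⊕ y)) lhs′-[]) ⟩
    scale c (word [] ▷ (∣ x ∷ v ∣ ⊕ y))   ≡⟨ cong (λ a → scale c (word [] ▷ a)) (∣∣-∷ʳ x v y) ⟨
    scale c (f [] ▷ ∣ x ∷ (v ∷ʳ y) ∣)     ∎

lhs′-∷-∷ʳ : ∀ x v y → lhs′ (x ∷ v) ≈ [] →
  (∀ p r → p ++ r ≡ v → lhs′ (r ∷ʳ y) ≈ []) →
  (∀ p r → p ++ r ≡ v → r ≢ [] → lhs′ r ≈ []) →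
  lhs′ (x ∷ v ∷ʳ y) ≈ []
lhs′-∷-∷ʳ x v y init-vanishes suffix∷ʳ-vanishes suffix-vanishes = begin
  lhs′ (x ∷ v ∷ʳ y)
    ≈⟨ lhs′-∷ʳ (x ∷ v) y ⟩
  lhs′ (x ∷ v) ▷ y ++ mixedSum (x ∷ v) y ++ term (x ∷ v ∷ʳ y) []
    ≈⟨ ++-cong (mapWords-cong (_∷ʳ y) init-vanishes)
               (++-cong (mixedSum-∷≈ x v y suffix∷ʳ-vanishes suffix-vanishes) last-term) ⟩
  scale c D ++ scale (- c) D
    ≈⟨ scale-cancel c D ⟩
  [] ∎
  where
  open ≈-Reasoning
  c = sgn (x ∷ v)
  D = Σsplits (v ∷ʳ y) (λ p q → f q ▷ ∣ x ∷ p ∣)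
  last-term : term (x ∷ v ∷ʳ y) [] ≈ scale (- c) D
  last-term = begin
    scale (sgn (x ∷ v ∷ʳ y)) (f (x ∷ v ∷ʳ y) ⋆ʷ [])
      ≈⟨ scale-cong (sgn (x ∷ v ∷ʳ y)) (⋆ʷ-[] (f (x ∷ v ∷ʳ y))) ⟩
    scale (sgn (x ∷ v ∷ʳ y)) (f (x ∷ v ∷ʳ y))
      ≈⟨ scale-cong (sgn (x ∷ v ∷ʳ y)) (f-∷ x (v ∷ʳ y)) ⟩
    scale (sgn (x ∷ v ∷ʳ y)) D
      ≡⟨ cong (λ d → scale d D) (sgn-∷ʳ (x ∷ v) y) ⟩
    scale (- c) D ∎

∷ʳ≢[] : ∀ (r : Word) y → r ∷ʳ y ≢ []
∷ʳ≢[] [] y ()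
∷ʳ≢[] (_ ∷ _) y ()

suffix-length : ∀ (p r : Word) {v} → p ++ r ≡ v → length r ℕ.≤ length v
suffix-length p r refl = List.length-++-≤ʳ r {p}

length-∷ʳ : ∀ (u : Word) y → length (u ∷ʳ y) ≡ suc (length u)
length-∷ʳ u y = trans (List.length-++ u) (ℕ.+-comm (length u) 1)

lhs′≈[] : ∀ w → w ≢ [] → lhs′ w ≈ []
lhs′≈[] = All.wfRec (On.wellFounded length <-wellFounded) _ (λ w → w ≢ [] → lhs′ w ≈ []) step
  where
  step : ∀ w → (∀ {u} → length u ℕ.< length w → u ≢ [] → lhs′ u ≈ []) → w ≢ [] → lhs′ w ≈ []
  step w ih w≢[] with initLast w
  ... | [] = ⊥-elim (w≢[] refl)
  ... | [] ∷ʳ′ y = lhs′-[ y ]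
  ... | (x ∷ v) ∷ʳ′ y = lhs′-∷-∷ʳ x v y
    (ih {x ∷ v} (s≤s (ℕ.≤-reflexive (sym (length-∷ʳ v y)))) λ ())
    (λ p r p++r≡v → ih {r ∷ʳ y} (s≤s (suffix-length p (r ∷ʳ y) (suffix-∷ʳ p r p++r≡v))) (∷ʳ≢[] r y))
    (λ p r p++r≡v r≢[] → ih {r} (s≤s (ℕ.≤-trans (suffix-length p r p++r≡v) (List.length-++-≤ˡ v))) r≢[])
    where
    suffix-∷ʳ : ∀ p r → p ++ r ≡ v → p ++ r ∷ʳ y ≡ v ∷ʳ y
    suffix-∷ʳ p r p++r≡v = trans (sym (List.++-assoc p r [ y ])) (cong (_∷ʳ y) p++r≡v)

lemma1p8 : (w : Word) → w ≢ [] → IsZero (lhs w)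
lemma1p8 w w≢[] = ≈⇒coeff≡ (≈-trans (lhs≈lhs′ w) (lhs′≈[] w w≢[]))
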